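{- Let $r,s$ be distinct relation variables. There is no relational algebra expression that is polymorphically equivalent to the semijoin $r\ltimes s$; that is, there is no relational algebra expression $e$ with ${\it Relvars}(e)\subseteq\{r,s\}$ such that for every type assignment $\mathcal{T}$ on $\{r,s\}$, $e$ is well-typed under $\mathcal{T}$ with output type $\mathcal{T}(r)$, and for every database $\mathbf{D}$ of type $\mathcal{T}$ the value of $e$ on $\mathbf{D}$ equals $\{t\in\mathbf{D}(r)\mid \exists t'\in\mathbf{D}(s)\ \forall B\in\mathcal{T}(r)\cap\mathcal{T}(s):\ t(B)=t'(B)\}$.
   Context: A type is a finite set of attribute names; a type assignment on a finite set $S$ of relation variables maps each $r\in S$ to a type. Relational algebra expressions are generated by $e \to r \mid (e\cup e)\mid (e-e)\mid (e\Join e)\mid (e\times e)\mid \sigma_{\theta(A_1,\ldots,A_n)}(e)\mid \pi_{A_1,\ldots,A_n}(e)\mid \rho_{A/B}(e)\mid \widehat{\pi}_A(e)$, with $r$ a relation variable, $A,B,A_i$ attribute names ($n\ge0$), $\theta$ a selection predicate. ${\it Relvars}(e)$ is the set of relation variables occurring in $e$. The judgment $\mathcal{T}\vdash e:\tau$ (for $\mathcal{T}$ a type assignment on a set containing ${\it Relvars}(e)$) is defined inductively: $\mathcal{T}\vdash r:\mathcal{T}(r)$; if $\mathcal{T}\vdash e_1:\tau$ and $\mathcal{T}\vdash e_2:\tau$ then $\mathcal{T}\vdash (e_1\cup e_2):\tau$ and $\mathcal{T}\vdash(e_1-e_2):\tau$; if $\mathcal{T}\vdash e_1:\tau_1$,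 $\mathcal{T}\vdash e_2:\tau_2$ then $\mathcal{T}\vdash (e_1\Join e_2):\tau_1\cup\tau_2$, and if moreover $\tau_1\cap\tau_2=\emptyset$ then $\mathcal{T}\vdash(e_1\times e_2):\tau_1\cup\tau_2$; if $\mathcal{T}\vdash e:\tau$ and $A_1,\ldots,A_n\in\tau$ then $\mathcal{T}\vdash \sigma_{\theta(A_1,\ldots,A_n)}(e):\tau$ and $\mathcal{T}\vdash\pi_{A_1,\ldots,A_n}(e):\{A_1,\ldots,A_n\}$; if $\mathcal{T}\vdash e:\tau$, $A\in\tau$, $B\notin\tau$ then $\mathcal{T}\vdash\rho_{A/B}(e):(\tau-\{A\})\cup\{B\}$; if $\mathcal{T}\vdash e:\tau$ and $A\in\tau$ then $\mathcal{T}\vdash\widehat{\pi}_A(e):\tau-\{A\}$. The expression is well-typed under $\mathcal{T}$ with output type $\tau$ if $\mathcal{T}\vdash e:\tau$. Semantics: fix a universe $\mathbf{U}$ of data elements (with at least the elements needed). A tuple of type $\tau$ is a map $\tau\to\mathbf{U}$; a relation of type $\tau$ is a finite set of such tuples; a database of type $\mathcal{T}$ (on $S$) maps each $r\in S$ to a relation $\mathbf{D}(r)$ of type $\mathcal{T}(r)$. If $\mathcal{T}\vdash e:\tau$, $e$ evaluates on each database of type $\mathcal{T}$ to a relation of type $\tau$ in the standard way ($\cup,-$ set operations; $\Join$ natural join; $\times$ cartesian product; $\sigma_\theta$ selects tuples satisfying $\theta$; $\pi_{A_1..A_n}$ projects onto $A_1,\ldots,A_n$; $\rho_{A/B}$ renames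 attribute $A$ to $B$; $\widehat\pi_A$ projects out attribute $A$ keeping all others). -}

module Defs where

open import Data.Nat using (ℕ; _≟_)
open import Data.Bool using (Bool; true; false; if_then_else_)
open import Data.List using (List; []; _∷_; _++_; map; filter)
open import Data.List.Membership.Propositional using (_∈_; _∉_)
open import Data.List.Relation.Unary.All using (All)
open import Data.List.Relation.Unary.Any using (Any)
open import Data.Product using (Σ; _×_; _,_; ∃)
open import Data.Sum using (_⊎_)
open import Relation.Binary.PropositionalEquality using (_≡_)
open import Relation.Nullary using (¬_; does)
open import Relation.Nullary.Decidable using (¬?)
open import Function.Bundles using (_⇔_)

Attr : Set
Attr = ℕ

RelVar : Set
RelVar = ℕ

U : Set
U = ℕ

-- A type is a finite set of attribute names, represented by a list
-- (order and multiplicity irrelevant; compared with _≋_).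
Ty : Set
Ty = List Attr

_≋_ : Ty → Ty → Set
τ ≋ τ' = ∀ a → (a ∈ τ) ⇔ (a ∈ τ')

Disjoint : Ty → Ty → Set
Disjoint τ τ' = ∀ a → a ∈ τ → a ∉ τ'

remove : Attr → Ty → Ty
remove A τ = filter (λ x → ¬? (x ≟ A)) τ

-- Relational algebra expressions.  A selection predicate θ(A₁,…,Aₙ) is an
-- arbitrary (decidable) predicate on the list of values of A₁,…,Aₙ.
data Expr : Set where
  var     : RelVar → Expr
  _∪ᵉ_    : Expr → Expr → Expr
  _−ᵉ_    : Expr → Expr → Expr
  _⋈ᵉ_    : Expr → Expr → Expr
  _×ᵉ_    : Expr → Expr → Expr
  select  : (As : List Attr) → (θ : List U → Bool) → Expr → Expr
  project : (As : List Attr) → Expr → Expr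
  rename  : (A B : Attr) → Expr → Expr
  projout : (A : Attr) → Expr → Expr

Relvars : Expr → List RelVar
Relvars (var r) = r ∷ []
Relvars (e₁ ∪ᵉ e₂) = Relvars e₁ ++ Relvars e₂
Relvars (e₁ −ᵉ e₂) = Relvars e₁ ++ Relvars e₂
Relvars (e₁ ⋈ᵉ e₂) = Relvars e₁ ++ Relvars e₂
Relvars (e₁ ×ᵉ e₂) = Relvars e₁ ++ Relvars e₂
Relvars (select _ _ e) = Relvars e
Relvars (project _ e) = Relvars e
Relvars (rename _ _ e) = Relvars e
Relvars (projout _ e) = Relvars e

-- A type assignment (only its values on the relevant relation variables matter).
TypeAssignment : Set
TypeAssignment = RelVar → Ty

data _⊢_∶_ (T : TypeAssignment) : Expr → Ty → Set where
  ⊢var     : ∀ {r} → T ⊢ var r ∶ T r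
  ⊢∪       : ∀ {e₁ e₂ τ₁ τ₂} → T ⊢ e₁ ∶ τ₁ → T ⊢ e₂ ∶ τ₂ → τ₁ ≋ τ₂ → T ⊢ (e₁ ∪ᵉ e₂) ∶ τ₁
  ⊢−       : ∀ {e₁ e₂ τ₁ τ₂} → T ⊢ e₁ ∶ τ₁ → T ⊢ e₂ ∶ τ₂ → τ₁ ≋ τ₂ → T ⊢ (e₁ −ᵉ e₂) ∶ τ₁
  ⊢⋈       : ∀ {e₁ e₂ τ₁ τ₂} → T ⊢ e₁ ∶ τ₁ → T ⊢ e₂ ∶ τ₂ → T ⊢ (e₁ ⋈ᵉ e₂) ∶ (τ₁ ++ τ₂)
  ⊢×       : ∀ {e₁ e₂ τ₁ τ₂} → T ⊢ e₁ ∶ τ₁ → T ⊢ e₂ ∶ τ₂ → Disjoint τ₁ τ₂ → T ⊢ (e₁ ×ᵉ e₂) ∶ (τ₁ ++ τ₂)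
  ⊢select  : ∀ {e τ As θ} → T ⊢ e ∶ τ → All (_∈ τ) As → T ⊢ select As θ e ∶ τ
  ⊢project : ∀ {e τ As} → T ⊢ e ∶ τ → All (_∈ τ) As → T ⊢ project As e ∶ As
  ⊢rename  : ∀ {e τ A B} → T ⊢ e ∶ τ → A ∈ τ → B ∉ τ → T ⊢ rename A B e ∶ (B ∷ remove A τ)
  ⊢projout : ∀ {e τ A} → T ⊢ e ∶ τ → A ∈ τ → T ⊢ projout A e ∶ remove A τ

-- Tuples: a tuple of type τ is represented by any total map Attr → U;
-- only its values on τ matter (all notions below are invariant under
-- changing values outside τ).
Tuple : Set
Tuple = Attr → U

Agree : Ty → Tuple → Tuple → Set
Agree τ t u = ∀ a → a ∈ τ → t a ≡ u a

update : Tuple → Attr → U → Tuple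
update t A v x = if does (x ≟ A) then v else t x

Database : Set
Database = RelVar → List Tuple

-- Membership semantics: ⟦ e ⟧ D T t  means "the restriction of t to the output
-- type of e belongs to the value of e on D" (for well-typed e).
⟦_⟧ : Expr → TypeAssignment → Database → Tuple → Set
⟦ var r ⟧ T D t = Any (λ u → Agree (T r) t u) (D r)
⟦ e₁ ∪ᵉ e₂ ⟧ T D t = ⟦ e₁ ⟧ T D t ⊎ ⟦ e₂ ⟧ T D t
⟦ e₁ −ᵉ e₂ ⟧ T D t = ⟦ e₁ ⟧ T D t × ¬ ⟦ e₂ ⟧ T D t
⟦ e₁ ⋈ᵉ e₂ ⟧ T D t = ⟦ e₁ ⟧ T D t × ⟦ e₂ ⟧ T D t
⟦ e₁ ×ᵉ e₂ ⟧ T D t = ⟦ e₁ ⟧ T D t × ⟦ e₂ ⟧ T D t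
⟦ select As θ e ⟧ T D t = ⟦ e ⟧ T D t × θ (map t As) ≡ true
⟦ project As e ⟧ T D t = ∃ λ u → ⟦ e ⟧ T D u × Agree As t u
⟦ rename A B e ⟧ T D t = ⟦ e ⟧ T D (update t A (t B))
⟦ projout A e ⟧ T D t = ∃ λ v → ⟦ e ⟧ T D (update t A v)

Semijoin : TypeAssignment → Database → RelVar → RelVar → Tuple → Set
Semijoin T D r s t =
  Any (λ u → Agree (T r) t u) (D r) ×
  Any (λ u' → ∀ B → B ∈ T r → B ∈ T s → t B ≡ u' B) (D s)

-- Choose attributes B < C above every attribute occurring in e, type r by {B} and every other
-- relation variable by {B, C}. All types are then built from attributes that e never mentions,
-- so e cannot rename or project out anything, and its selections and projections are on the
-- empty attribute list. By induction, a subexpression whose type avoids C cannot separate two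
-- tuples that no C-free relation variable separates. Take D(r) = {1̄, 2̄} and every other
-- relation equal to {1̄} (constant tuples): the only C-free variable is r, which contains both
-- tuples, whereas the semijoin contains 1̄ but not 2̄.
module Submission where

open import Defs
open import Data.Empty using (⊥-elim)
open import Data.List using (List; []; _∷_; _++_)
open import Data.List.Extrema.Nat using (max; xs≤max)
open import Data.List.Membership.Propositional using (_∉_)
open import Data.List.Membership.Propositional.Properties using (∈-++⁺ˡ; ∈-++⁺ʳ)
open import Data.List.Relation.Unary.All as All using (All; []; _∷_)
open import Data.List.Relation.Unary.All.Properties using (++⁺; ++⁻ˡ; ++⁻ʳ)
open import Data.List.Relation.Unary.Any using (here; there)
open import Data.Nat using (ℕ; suc; _≤_; _<_; _≟_; s≤s)
open import Data.Nat.Properties using (<⇒≱; ≤-refl; n≤1+n; 1+n≢n)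
open import Data.Product using (Σ; ∃; _×_; _,_)
open import Data.Product.Function.NonDependent.Propositional using (_×-⇔_)
open import Data.Sum using (_⊎_)
open import Data.Sum.Function.Propositional using (_⊎-⇔_)
open import Function using (case_of_)
open import Function.Construct.Identity using (⇔-id)
open import Function.Bundles using (_⇔_; mk⇔; Equivalence)
open import Function.Related.TypeIsomorphisms using (¬-cong-⇔)
open import Relation.Binary.PropositionalEquality using (_≡_; refl; sym)
open import Relation.Nullary using (¬_; yes; no)

attrs : Expr → List Attr
attrs (var _) = []
attrs (e₁ ∪ᵉ e₂) = attrs e₁ ++ attrs e₂
attrs (e₁ −ᵉ e₂) = attrs e₁ ++ attrs e₂
attrs (e₁ ⋈ᵉ e₂) = attrs e₁ ++ attrs e₂
attrs (e₁ ×ᵉ e₂) = attrs e₁ ++ attrs e₂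
attrs (select As _ e) = As ++ attrs e
attrs (project As e) = As ++ attrs e
attrs (rename A B e) = A ∷ B ∷ attrs e
attrs (projout A e) = A ∷ attrs e

AttrsBelow : ℕ → Expr → Set
AttrsBelow m e = All (_< m) (attrs e)

attrsBelow-exists : (e : Expr) → ∃ λ m → AttrsBelow m e
attrsBelow-exists e = suc (max 0 (attrs e)) , All.map s≤s (xs≤max 0 (attrs e))

TyAtLeast : ℕ → Ty → Set
TyAtLeast m τ = All (m ≤_) τ

below-∉-TyAtLeast : ∀ {m τ A} → TyAtLeast m τ → A < m → A ∉ τ
below-∉-TyAtLeast τ-atLeast A<m A∈τ = <⇒≱ A<m (All.lookup τ-atLeast A∈τ)

∉-resp-≋ : ∀ {A τ₁ τ₂} → τ₁ ≋ τ₂ → A ∉ τ₁ → A ∉ τ₂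
∉-resp-≋ τ₁≋τ₂ A∉τ₁ A∈τ₂ = A∉τ₁ (Equivalence.from (τ₁≋τ₂ _) A∈τ₂)

∉-++⁻ˡ : ∀ {A : Attr} (τ₁ : Ty) {τ₂ : Ty} → A ∉ τ₁ ++ τ₂ → A ∉ τ₁
∉-++⁻ˡ _ A∉τ A∈τ₁ = A∉τ (∈-++⁺ˡ A∈τ₁)

∉-++⁻ʳ : ∀ {A : Attr} (τ₁ : Ty) {τ₂ : Ty} → A ∉ τ₁ ++ τ₂ → A ∉ τ₂
∉-++⁻ʳ τ₁ A∉τ A∈τ₂ = A∉τ (∈-++⁺ʳ τ₁ A∈τ₂)

module _ {m : ℕ} {T : TypeAssignment} (T-atLeast : ∀ x → TyAtLeast m (T x)) where

  output-TyAtLeast : ∀ {e τ} → AttrsBelow m e → T ⊢ e ∶ τ → TyAtLeast m τ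
  output-TyAtLeast _ (⊢var {r}) = T-atLeast r
  output-TyAtLeast {e₁ ∪ᵉ _} fresh (⊢∪ d₁ _ _) = output-TyAtLeast (++⁻ˡ (attrs e₁) fresh) d₁
  output-TyAtLeast {e₁ −ᵉ _} fresh (⊢− d₁ _ _) = output-TyAtLeast (++⁻ˡ (attrs e₁) fresh) d₁
  output-TyAtLeast {e₁ ⋈ᵉ _} fresh (⊢⋈ d₁ d₂) =
    ++⁺ (output-TyAtLeast (++⁻ˡ (attrs e₁) fresh) d₁)
        (output-TyAtLeast (++⁻ʳ (attrs e₁) fresh) d₂)
  output-TyAtLeast {e₁ ×ᵉ _} fresh (⊢× d₁ d₂ _) =
    ++⁺ (output-TyAtLeast (++⁻ˡ (attrs e₁) fresh) d₁)
        (output-TyAtLeast (++⁻ʳ (attrs e₁) fresh) d₂)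
  output-TyAtLeast {select As _ _} fresh (⊢select d _) = output-TyAtLeast (++⁻ʳ As fresh) d
  output-TyAtLeast {project As _} fresh (⊢project d As⊆τ) =
    All.map (All.lookup (output-TyAtLeast (++⁻ʳ As fresh) d)) As⊆τ
  output-TyAtLeast (A<m ∷ _ ∷ fresh) (⊢rename d A∈τ _) =
    ⊥-elim (below-∉-TyAtLeast (output-TyAtLeast fresh d) A<m A∈τ)
  output-TyAtLeast (A<m ∷ fresh) (⊢projout d A∈τ) =
    ⊥-elim (below-∉-TyAtLeast (output-TyAtLeast fresh d) A<m A∈τ)

  below-∉-output : ∀ {e τ A} → AttrsBelow m e → T ⊢ e ∶ τ → A < m → A ∉ τ
  below-∉-output fresh d = below-∉-TyAtLeast (output-TyAtLeast fresh d)

  module _ (D : Database) (C : Attr) (t t' : Tuple)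
           (vars-indist : ∀ x → C ∉ T x → ⟦ var x ⟧ T D t ⇔ ⟦ var x ⟧ T D t') where

    C-free-indist : ∀ {e τ} → AttrsBelow m e → T ⊢ e ∶ τ → C ∉ τ → ⟦ e ⟧ T D t ⇔ ⟦ e ⟧ T D t'
    C-free-indist _ (⊢var {x}) C∉τ = vars-indist x C∉τ
    C-free-indist {e₁ ∪ᵉ _} fresh (⊢∪ d₁ d₂ τ₁≋τ₂) C∉τ =
      C-free-indist (++⁻ˡ (attrs e₁) fresh) d₁ C∉τ
        ⊎-⇔ C-free-indist (++⁻ʳ (attrs e₁) fresh) d₂ (∉-resp-≋ τ₁≋τ₂ C∉τ)
    C-free-indist {e₁ −ᵉ _} fresh (⊢− d₁ d₂ τ₁≋τ₂) C∉τ =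
      C-free-indist (++⁻ˡ (attrs e₁) fresh) d₁ C∉τ
        ×-⇔ ¬-cong-⇔ (C-free-indist (++⁻ʳ (attrs e₁) fresh) d₂ (∉-resp-≋ τ₁≋τ₂ C∉τ))
    C-free-indist {e₁ ⋈ᵉ _} fresh (⊢⋈ {τ₁ = τ₁} d₁ d₂) C∉τ =
      C-free-indist (++⁻ˡ (attrs e₁) fresh) d₁ (∉-++⁻ˡ τ₁ C∉τ)
        ×-⇔ C-free-indist (++⁻ʳ (attrs e₁) fresh) d₂ (∉-++⁻ʳ τ₁ C∉τ)
    C-free-indist {e₁ ×ᵉ _} fresh (⊢× {τ₁ = τ₁} d₁ d₂ _) C∉τ =
      C-free-indist (++⁻ˡ (attrs e₁) fresh) d₁ (∉-++⁻ˡ τ₁ C∉τ)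
        ×-⇔ C-free-indist (++⁻ʳ (attrs e₁) fresh) d₂ (∉-++⁻ʳ τ₁ C∉τ)
    C-free-indist fresh (⊢select d []) C∉τ = C-free-indist fresh d C∉τ ×-⇔ ⇔-id _
    C-free-indist {select (_ ∷ As) _ _} (A<m ∷ fresh) (⊢select d (A∈τ ∷ _)) _ =
      ⊥-elim (below-∉-output (++⁻ʳ As fresh) d A<m A∈τ)
    C-free-indist _ (⊢project _ []) _ =
      mk⇔ (λ (u , u∈e , _) → u , u∈e , λ _ ()) (λ (u , u∈e , _) → u , u∈e , λ _ ())
    C-free-indist {project (_ ∷ As) _} (A<m ∷ fresh) (⊢project d (A∈τ ∷ _)) _ =
      ⊥-elim (below-∉-output (++⁻ʳ As fresh) d A<m A∈τ)
    C-free-indist (A<m ∷ _ ∷ fresh) (⊢rename d A∈τ _) _ =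
      ⊥-elim (below-∉-output fresh d A<m A∈τ)
    C-free-indist (A<m ∷ fresh) (⊢projout d A∈τ) _ =
      ⊥-elim (below-∉-output fresh d A<m A∈τ)

module SemijoinCounterexample (r : RelVar) (B : Attr) where

  C : Attr
  C = suc B

  T : TypeAssignment
  T x with x ≟ r
  ... | yes _ = B ∷ []
  ... | no _ = B ∷ C ∷ []

  one two : Tuple
  one _ = 1
  two _ = 2

  D : Database
  D x with x ≟ r
  ... | yes _ = one ∷ two ∷ []
  ... | no _ = one ∷ []

  T-atLeast : ∀ x → TyAtLeast B (T x)
  T-atLeast x with x ≟ r
  ... | yes _ = ≤-refl ∷ []
  ... | no _ = ≤-refl ∷ n≤1+n B ∷ []

  vars-indist : ∀ x → C ∉ T x → ⟦ var x ⟧ T D one ⇔ ⟦ var x ⟧ T D two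
  vars-indist x C∉Tx with x ≟ r
  ... | yes _ = mk⇔ (λ _ → there (here λ _ _ → refl)) (λ _ → here λ _ _ → refl)
  ... | no _ = ⊥-elim (C∉Tx (there (here refl)))

  C∉T-r : C ∉ T r
  C∉T-r with r ≟ r
  ... | yes _ = λ { (here C≡B) → 1+n≢n C≡B }
  ... | no r≢r = ⊥-elim (r≢r refl)

  module _ {s : RelVar} (s≢r : ¬ s ≡ r) where

    one-∈-semijoin : Semijoin T D r s one
    one-∈-semijoin with r ≟ r | s ≟ r
    ... | no r≢r | _ = ⊥-elim (r≢r refl)
    ... | yes _ | yes s≡r = ⊥-elim (s≢r s≡r)
    ... | yes _ | no _ = here (λ _ _ → refl) , here (λ _ _ _ → refl)

    two-∉-semijoin : ¬ Semijoin T D r s two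
    two-∉-semijoin with r ≟ r | s ≟ r
    ... | no r≢r | _ = ⊥-elim (r≢r refl)
    ... | yes _ | yes s≡r = ⊥-elim (s≢r s≡r)
    ... | yes _ | no _ = λ { (_ , here agree) → case agree B (here refl) (here refl) of λ () }

-- The counterexample types every variable other than r like s.
proposition3 : (r s : RelVar) → ¬ (r ≡ s) →
    ¬ (Σ Expr λ e →
        All (λ x → x ≡ r ⊎ x ≡ s) (Relvars e) ×
        ((T : TypeAssignment) →
          (Σ Ty λ τ → (T ⊢ e ∶ τ) × (τ ≋ T r)) ×
          ((D : Database) → (t : Tuple) →
            ⟦ e ⟧ T D t ⇔ Semijoin T D r s t)))
proposition3 r s r≢s (e , _ , polymorphic) with attrsBelow-exists e
... | m , fresh with polymorphic (SemijoinCounterexample.T r m)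
... | (τ , ⊢e , τ≋T-r) , ⟦e⟧⇔semijoin = two-∉-semijoin s≢r (to (⟦e⟧⇔semijoin D two) two-∈-e)
  where
  open SemijoinCounterexample r m
  open Equivalence

  s≢r : ¬ s ≡ r
  s≢r s≡r = r≢s (sym s≡r)

  C∉τ : C ∉ τ
  C∉τ C∈τ = C∉T-r (to (τ≋T-r C) C∈τ)

  two-∈-e : ⟦ e ⟧ T D two
  two-∈-e = to (C-free-indist T-atLeast D C one two vars-indist fresh ⊢e C∉τ)
               (from (⟦e⟧⇔semijoin D one) (one-∈-semijoin s≢r))
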